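{- Let $G=(V,E)$ be a finite simple undirected graph with $V=\{1,\dots,n\}$. For $i,j\in V$ let $a_{ij}=1$ if $i=j$ or $d(i,j)=2$, and $a_{ij}=0$ otherwise; and let $b_{ij}=-1$ if $i=j$, $b_{ij}=1$ if $ij\in E$, and $b_{ij}=0$ otherwise. Then the optimal value of the integer program $$\min \sum_{i=1}^n x_i \ \text{ s.t. }\ \sum_{j=1}^n a_{ij}x_j\ge 1,\ \ \sum_{j=1}^n b_{ij}x_j<\deg_G(i),\ \ x_i\in\{0,1\}\quad(\forall i\in V)$$ equals the restrained hop domination number $\gamma_{rh}(G)$.
   Context: $d(u,v)$ is the distance in $G$; $\deg_G(i)$ is the number of neighbours of $i$. A set $S\subseteq V$ is a hop dominating set if for every $u\in V\setminus S$ there is $v\in S$ with $d(u,v)=2$. A hop dominating set $S$ is a restrained hop dominating set if for every $u\in V\setminus S$ there exists $v\in V\setminus S$ with $d(u,v)=1$. $\gamma_{rh}(G)$ is the minimum cardinality of a restrained hop dominating set of $G$. -}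

module Defs where

open import Data.Bool using (Bool; true; false; T)
open import Data.Nat using (ℕ; zero; suc; _≤_)
open import Data.Integer as ℤ using (ℤ; +_; -[1+_])
open import Data.Fin using (Fin; zero; suc)
open import Data.Fin.Properties using (any?) renaming (_≟_ to _≟ᶠ_)
open import Data.Fin.Subset using (Subset; _∈_; _∉_; ∣_∣)
open import Data.Product using (Σ; ∃; _×_; _,_)
open import Data.Sum using (_⊎_)
open import Relation.Nullary using (¬_; Dec; yes; no)
open import Relation.Nullary.Decidable using (_×-dec_; ¬?)
open import Relation.Binary.PropositionalEquality using (_≡_)
open import Data.Bool.Properties using (T?)

record Graph (n : ℕ) : Set where
  field
    adj      : Fin n → Fin n → Bool
    adj-sym  : ∀ i j → adj i j ≡ adj j i
    loopless : ∀ i → adj i i ≡ false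
open Graph public

module _ {n : ℕ} (G : Graph n) where

  Adj : Fin n → Fin n → Set
  Adj i j = T (adj G i j)

  Adj? : ∀ i j → Dec (Adj i j)
  Adj? i j = T? (adj G i j)

  Dist2 : Fin n → Fin n → Set
  Dist2 u v = ¬ (u ≡ v) × ¬ Adj u v × ∃ λ w → Adj u w × Adj w v

  Dist2? : ∀ u v → Dec (Dist2 u v)
  Dist2? u v = ¬? (u ≟ᶠ v) ×-dec (¬? (Adj? u v) ×-dec any? (λ w → Adj? u w ×-dec Adj? w v))

sumℤ : ∀ {n} → (Fin n → ℤ) → ℤ
sumℤ {zero}  f = + 0
sumℤ {suc n} f = f zero ℤ.+ sumℤ (λ i → f (suc i))

count : ∀ {n} → (Fin n → Bool) → ℕ
count {zero}  p = 0
count {suc n} p with p zero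
... | true  = suc (count (λ i → p (suc i)))
... | false = count (λ i → p (suc i))

module _ {n : ℕ} (G : Graph n) where

  deg : Fin n → ℕ
  deg i = count (adj G i)

  HopDominating : Subset n → Set
  HopDominating S = ∀ u → u ∉ S → ∃ λ v → v ∈ S × Dist2 G u v

  RestrainedHopDominating : Subset n → Set
  RestrainedHopDominating S =
    HopDominating S × (∀ u → u ∉ S → ∃ λ v → v ∉ S × Adj G u v)

  IsRestrainedHopDominationNumber : ℕ → Set
  IsRestrainedHopDominationNumber k =
    (Σ (Subset n) λ S → RestrainedHopDominating S × ∣ S ∣ ≡ k)
    × (∀ S → RestrainedHopDominating S → k ≤ ∣ S ∣)

  a : Fin n → Fin n → ℤ
  a i j with i ≟ᶠ j
  ... | yes _ = + 1
  ... | no _ with Dist2? G i j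
  ...   | yes _ = + 1
  ...   | no _  = + 0

  b : Fin n → Fin n → ℤ
  b i j with i ≟ᶠ j
  ... | yes _ = -[1+ 0 ]
  ... | no _ with adj G i j
  ...   | true  = + 1
  ...   | false = + 0

  Feasible : (Fin n → ℤ) → Set
  Feasible x =
    (∀ i → x i ≡ + 0 ⊎ x i ≡ + 1)
    × (∀ i → + 1 ℤ.≤ sumℤ (λ j → a i j ℤ.* x j))
    × (∀ i → sumℤ (λ j → b i j ℤ.* x j) ℤ.< + deg i)

  objective : (Fin n → ℤ) → ℤ
  objective x = sumℤ x

  IsOptimalValue : ℤ → Set
  IsOptimalValue k =
    (Σ (Fin n → ℤ) λ x → Feasible x × objective x ≡ k)
    × (∀ x → Feasible x → k ℤ.≤ objective x)

-- Identify a 0/1 vector x with the set S whose characteristic vector it is. At a vertex u the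
-- first constraint row counts the v ∈ S with v = u or d(u,v) = 2, so it holds iff u ∈ S or u is
-- hop dominated by S. In the second row, deg(u) minus the left-hand side counts the v with
-- v = u ∈ S or with uv ∈ E and v ∉ S, so it holds iff u ∈ S or u has a neighbour outside S.
-- Hence the feasible points are exactly the characteristic vectors of the restrained hop
-- dominating sets, with objective value |S|; a minimum such set exists since V itself is one.
module Submission where

open import Defs
open import Data.Bool using (Bool; true; false; T)
open import Data.Nat as ℕ using (ℕ; zero; suc; z≤n; s≤s)
import Data.Nat.Properties as ℕ
open import Data.Nat.Induction using (<-wellFounded)
open import Data.Integer using (ℤ; +_; _+_; _*_; _≤_; _<_; +≤+; +<+)
open import Data.Integer.Properties
  using (+-commutativeSemigroup; +-identityˡ; +-identityʳ; +-monoʳ-≤; +-monoʳ-<; ≤-trans; ≤-reflexive;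
         <⇒≱; ≰⇒>; drop‿+<+; i<j⇒suc[i]≤j; suc[i]≤j⇒i<j; _≟_)
open import Data.Fin using (Fin; zero; suc)
open import Data.Fin.Properties using (any?; all?) renaming (_≟_ to _≟ᶠ_)
open import Data.Fin.Subset using (Subset; _∈_; _∉_; ∣_∣; ⊤)
open import Data.Fin.Subset.Properties using (_∈?_; ∈⊤; anySubset?)
open import Data.Vec using ([]; _∷_; tabulate)
open import Data.Product using (Σ; ∃; _×_; _,_; proj₁)
open import Data.Sum using (_⊎_; inj₁; inj₂; [_,_])
open import Function using (_∘_; id; flip; _⇔_; mk⇔; Equivalence)
open import Induction.WellFounded using (Acc; acc)
open import Relation.Nullary using (Dec; yes; no; contradiction)
open import Relation.Nullary.Decidable
  using (⌊_⌋; toWitness; fromWitness; _×-dec_; _⊎-dec_; _→-dec_; ¬?)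
open import Relation.Unary using (Pred; Decidable)
open import Relation.Binary.PropositionalEquality hiding ([_])
open Equivalence using (to; from)
open import Function.Related.Propositional using (module EquationalReasoning)
open import Algebra.Properties.CommutativeSemigroup +-commutativeSemigroup
  using () renaming (interchange to +-interchange)

bit : Bool → ℤ
bit true  = + 1
bit false = + 0

bit-binary : ∀ b → bit b ≡ + 0 ⊎ bit b ≡ + 1
bit-binary false = inj₁ refl
bit-binary true  = inj₂ refl

χ : ∀ {n} → Subset n → Fin n → ℤ
χ S j = bit ⌊ j ∈? S ⌋

sumℤ-cong : ∀ {n} {f g : Fin n → ℤ} → f ≗ g → sumℤ f ≡ sumℤ g
sumℤ-cong {zero}  f≗g = refl
sumℤ-cong {suc n} f≗g = cong₂ _+_ (f≗g zero) (sumℤ-cong (f≗g ∘ suc))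

sumℤ-+ : ∀ {n} (f g : Fin n → ℤ) → sumℤ f + sumℤ g ≡ sumℤ (λ j → f j + g j)
sumℤ-+ {zero}  f g = refl
sumℤ-+ {suc n} f g =
  trans (+-interchange (f zero) _ (g zero) _) (cong (_+_ (f zero + g zero)) (sumℤ-+ (f ∘ suc) (g ∘ suc)))

sumℤ-bit : ∀ {n} (p : Fin n → Bool) → sumℤ (bit ∘ p) ≡ + count p
sumℤ-bit {zero}  p = refl
sumℤ-bit {suc n} p with p zero
... | true  = cong (_+_ (+ 1)) (sumℤ-bit (p ∘ suc))
... | false = trans (+-identityˡ _) (sumℤ-bit (p ∘ suc))

count-pos⇔∃ : ∀ {n} (p : Fin n → Bool) → 0 ℕ.< count p ⇔ ∃ (T ∘ p)
count-pos⇔∃ p = mk⇔ (witness p) (positive p)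
  where
  witness : ∀ {n} (p : Fin n → Bool) → 0 ℕ.< count p → ∃ (T ∘ p)
  witness {suc n} p pos with p zero in p0
  ... | true  = zero , subst T (sym p0) _
  ... | false = let j , t = witness (p ∘ suc) pos in suc j , t
  positive : ∀ {n} (p : Fin n → Bool) → ∃ (T ∘ p) → 0 ℕ.< count p
  positive {suc n} p (zero , t) with p zero
  ... | true = s≤s z≤n
  positive {suc n} p (suc j , t) with p zero
  ... | true  = s≤s z≤n
  ... | false = positive (p ∘ suc) (j , t)

0<sumℤ-indicator⇔∃ : ∀ {n p} {P : Pred (Fin n) p} (P? : Decidable P) →
                       + 0 < sumℤ (λ j → bit ⌊ P? j ⌋) ⇔ ∃ P
0<sumℤ-indicator⇔∃ P? = mk⇔
  (λ pos → let j , t = to (count-pos⇔∃ p) (drop‿+<+ (subst (+ 0 <_) (sumℤ-bit p) pos))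
           in j , toWitness t)
  (λ (j , Pj) → subst (+ 0 <_) (sym (sumℤ-bit p)) (+<+ (from (count-pos⇔∃ p) (j , fromWitness Pj))))
  where
  p : Fin _ → Bool
  p j = ⌊ P? j ⌋

i<i+j⇔0<j : ∀ i j → i < i + j ⇔ + 0 < j
i<i+j⇔0<j i j = mk⇔
  (λ i<i+j → ≰⇒> λ j≤0 → <⇒≱ i<i+j (≤-trans (+-monoʳ-≤ i j≤0) (≤-reflexive (+-identityʳ i))))
  (λ 0<j → subst (_< i + j) (+-identityʳ i) (+-monoʳ-< i 0<j))

1≤⇔0< : ∀ i → + 1 ≤ i ⇔ + 0 < i
1≤⇔0< i = mk⇔ suc[i]≤j⇒i<j i<j⇒suc[i]≤j

∃-≡×⊎⇔ : ∀ {a p q} {A : Set a} {P : A → Set p} {Q : A → Set q} (u : A) →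
         (∃ λ v → (u ≡ v × P v) ⊎ Q v) ⇔ (P u ⊎ ∃ Q)
∃-≡×⊎⇔ u = mk⇔
  (λ { (v , inj₁ (refl , Pu)) → inj₁ Pu ; (v , inj₂ Qv) → inj₂ (v , Qv) })
  (λ { (inj₁ Pu) → u , inj₁ (refl , Pu) ; (inj₂ (v , Qv)) → v , inj₂ Qv })

∀∈⊎⇔∀∉→ : ∀ {n q} (S : Subset n) {Q : Fin n → Set q} →
          (∀ u → u ∈ S ⊎ Q u) ⇔ (∀ u → u ∉ S → Q u)
∀∈⊎⇔∀∉→ S {Q} = mk⇔ (λ cover u u∉S → [ flip contradiction u∉S , id ] (cover u)) fill-∈
  where
  fill-∈ : (∀ u → u ∉ S → Q u) → ∀ u → u ∈ S ⊎ Q u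
  fill-∈ cover u with u ∈? S
  ... | yes u∈S = inj₁ u∈S
  ... | no  u∉S = inj₂ (cover u u∉S)

∃-minimum-cardinality : ∀ {n p} {P : Pred (Subset n) p} → Decidable P → ∃ P →
                     ∃ λ S → P S × (∀ T → P T → ∣ S ∣ ℕ.≤ ∣ T ∣)
∃-minimum-cardinality {P = P} P? (S , PS) = descend S PS (<-wellFounded ∣ S ∣)
  where
  descend : ∀ S → P S → Acc ℕ._<_ ∣ S ∣ → ∃ λ S → P S × (∀ T → P T → ∣ S ∣ ℕ.≤ ∣ T ∣)
  descend S PS (acc smaller) with anySubset? (λ T → P? T ×-dec ∣ T ∣ ℕ.<? ∣ S ∣)
  ... | yes (T , PT , T<S) = descend T PT (smaller T<S)
  ... | no  noneSmaller   = S , PS , λ T PT → ℕ.≮⇒≥ (λ T<S → noneSmaller (T , PT , T<S))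

-- ⌊_⌋ does not compute through the Dec.map′ in the successor case of _∈?_.
∈?-there : ∀ {n} s (S : Subset n) j → ⌊ suc j ∈? s ∷ S ⌋ ≡ ⌊ j ∈? S ⌋
∈?-there s S j with j ∈? S
... | yes _ = refl
... | no  _ = refl

sumℤ-χ : ∀ {n} (S : Subset n) → sumℤ (χ S) ≡ + ∣ S ∣
sumℤ-χ []          = refl
sumℤ-χ (true  ∷ S) = cong (_+_ (+ 1)) (trans (sumℤ-cong (cong bit ∘ ∈?-there true S)) (sumℤ-χ S))
sumℤ-χ (false ∷ S) = trans (+-identityˡ _) (trans (sumℤ-cong (cong bit ∘ ∈?-there false S)) (sumℤ-χ S))

∈?-tabulate : ∀ {n} (f : Fin n → Bool) j → ⌊ j ∈? tabulate f ⌋ ≡ f j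
∈?-tabulate f zero with f zero
... | true  = refl
... | false = refl
∈?-tabulate f (suc j) = trans (∈?-there (f zero) _ j) (∈?-tabulate (f ∘ suc) j)

support : ∀ {n} → (Fin n → ℤ) → Subset n
support x = tabulate (λ j → ⌊ x j ≟ + 1 ⌋)

χ-support : ∀ {n} (x : Fin n → ℤ) → (∀ j → x j ≡ + 0 ⊎ x j ≡ + 1) → x ≗ χ (support x)
χ-support x binary j rewrite ∈?-tabulate (λ j → ⌊ x j ≟ + 1 ⌋) j with binary j
... | inj₁ xj≡0 rewrite xj≡0 = refl
... | inj₂ xj≡1 rewrite xj≡1 = refl

module _ {n : ℕ} (G : Graph n) where

  a≡indicator : ∀ u j (d : Dec (u ≡ j ⊎ Dist2 G u j)) → a G u j ≡ bit ⌊ d ⌋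
  a≡indicator u j d with u ≟ᶠ j | d
  ... | yes _   | yes _  = refl
  ... | yes u≡j | no  ¬d = contradiction (inj₁ u≡j) ¬d
  ... | no  u≢j | d′ with Dist2? G u j | d′
  ...   | yes _     | yes _           = refl
  ...   | yes dist  | no  ¬d          = contradiction (inj₂ dist) ¬d
  ...   | no  _     | yes (inj₁ u≡j)  = contradiction u≡j u≢j
  ...   | no  ¬dist | yes (inj₂ dist) = contradiction dist ¬dist
  ...   | no  _     | no  _           = refl

  a*indicator≡indicator : ∀ {p} {P : Set p} (s : Dec P) u j →
    a G u j * bit ⌊ s ⌋ ≡ bit ⌊ (u ≟ᶠ j ×-dec s) ⊎-dec (s ×-dec Dist2? G u j) ⌋
  a*indicator≡indicator s u j =
    trans (cong (_* bit ⌊ s ⌋) (a≡indicator u j (u ≟ᶠ j ⊎-dec Dist2? G u j)))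
          (distrib (u ≟ᶠ j) (Dist2? G u j) s)
    where
    distrib : ∀ {e d p} {E : Set e} {D : Set d} {P : Set p} (e? : Dec E) (d? : Dec D) (s : Dec P) →
              bit ⌊ e? ⊎-dec d? ⌋ * bit ⌊ s ⌋ ≡ bit ⌊ (e? ×-dec s) ⊎-dec (s ×-dec d?) ⌋
    distrib (yes _) _       (yes _) = refl
    distrib (yes _) _       (no  _) = refl
    distrib (no  _) (yes _) (yes _) = refl
    distrib (no  _) (yes _) (no  _) = refl
    distrib (no  _) (no  _) (yes _) = refl
    distrib (no  _) (no  _) (no  _) = refl

  b*indicator+indicator≡adj : ∀ {p} {P : Set p} (s : Dec P) u j →
    b G u j * bit ⌊ s ⌋ + bit ⌊ (u ≟ᶠ j ×-dec s) ⊎-dec (¬? s ×-dec Adj? G u j) ⌋ ≡ bit (adj G u j)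
  b*indicator+indicator≡adj s u j with u ≟ᶠ j | s
  ... | yes refl | yes _ rewrite loopless G u = refl
  ... | yes refl | no  _ rewrite loopless G u = refl
  ... | no  _    | s′ with adj G u j | s′
  ...   | true  | yes _ = refl
  ...   | true  | no  _ = refl
  ...   | false | yes _ = refl
  ...   | false | no  _ = refl

  covers? : ∀ S u → Decidable (λ v → (u ≡ v × v ∈ S) ⊎ (v ∈ S × Dist2 G u v))
  covers? S u v = (u ≟ᶠ v ×-dec v ∈? S) ⊎-dec (v ∈? S ×-dec Dist2? G u v)

  restrains? : ∀ S u → Decidable (λ v → (u ≡ v × v ∈ S) ⊎ (v ∉ S × Adj G u v))
  restrains? S u v = (u ≟ᶠ v ×-dec v ∈? S) ⊎-dec (¬? (v ∈? S) ×-dec Adj? G u v)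

  restraintRow+restraintCount≡deg : ∀ S u →
    sumℤ (λ j → b G u j * χ S j) + sumℤ (λ j → bit ⌊ restrains? S u j ⌋) ≡ + deg G u
  restraintRow+restraintCount≡deg S u = begin
    sumℤ (λ j → b G u j * χ S j) + sumℤ (λ j → bit ⌊ restrains? S u j ⌋)
      ≡⟨ sumℤ-+ (λ j → b G u j * χ S j) (λ j → bit ⌊ restrains? S u j ⌋) ⟩
    sumℤ (λ j → b G u j * χ S j + bit ⌊ restrains? S u j ⌋)
      ≡⟨ sumℤ-cong (λ j → b*indicator+indicator≡adj (j ∈? S) u j) ⟩
    sumℤ (bit ∘ adj G u)
      ≡⟨ sumℤ-bit (adj G u) ⟩
    + deg G u ∎
    where open ≡-Reasoning

  hopConstraint⇔ : ∀ S u → + 1 ≤ sumℤ (λ j → a G u j * χ S j) ⇔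
                           (u ∈ S ⊎ ∃ λ v → v ∈ S × Dist2 G u v)
  hopConstraint⇔ S u = begin
    + 1 ≤ sumℤ (λ j → a G u j * χ S j)                  ∼⟨ 1≤⇔0< _ ⟩
    + 0 < sumℤ (λ j → a G u j * χ S j)
      ≡⟨ cong (+ 0 <_) (sumℤ-cong (λ j → a*indicator≡indicator (j ∈? S) u j)) ⟩
    + 0 < sumℤ (λ j → bit ⌊ covers? S u j ⌋)            ∼⟨ 0<sumℤ-indicator⇔∃ (covers? S u) ⟩
    (∃ λ v → (u ≡ v × v ∈ S) ⊎ (v ∈ S × Dist2 G u v))  ∼⟨ ∃-≡×⊎⇔ u ⟩
    (u ∈ S ⊎ ∃ λ v → v ∈ S × Dist2 G u v)               ∎
    where open EquationalReasoning

  restraintConstraint⇔ : ∀ S u → sumℤ (λ j → b G u j * χ S j) < + deg G u ⇔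
                                 (u ∈ S ⊎ ∃ λ v → v ∉ S × Adj G u v)
  restraintConstraint⇔ S u = begin
    B < + deg G u
      ≡⟨ cong (B <_) (sym (restraintRow+restraintCount≡deg S u)) ⟩
    B < B + R                                          ∼⟨ i<i+j⇔0<j B R ⟩
    + 0 < R                                            ∼⟨ 0<sumℤ-indicator⇔∃ (restrains? S u) ⟩
    (∃ λ v → (u ≡ v × v ∈ S) ⊎ (v ∉ S × Adj G u v))   ∼⟨ ∃-≡×⊎⇔ u ⟩
    (u ∈ S ⊎ ∃ λ v → v ∉ S × Adj G u v)               ∎
    where
    open EquationalReasoning
    B R : ℤ
    B = sumℤ (λ j → b G u j * χ S j)
    R = sumℤ (λ j → bit ⌊ restrains? S u j ⌋)

  feasible-χ⇔restrainedHopDominating : ∀ S → Feasible G (χ S) ⇔ RestrainedHopDominating G S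
  feasible-χ⇔restrainedHopDominating S = mk⇔
    (λ (_ , hop , restraint) →
       to (∀∈⊎⇔∀∉→ S) (to (hopConstraint⇔ S _) ∘ hop) ,
       to (∀∈⊎⇔∀∉→ S) (to (restraintConstraint⇔ S _) ∘ restraint))
    (λ (hopDominating , restrained) →
       (λ j → bit-binary ⌊ j ∈? S ⌋) ,
       (λ u → from (hopConstraint⇔ S u) (from (∀∈⊎⇔∀∉→ S) hopDominating u)) ,
       (λ u → from (restraintConstraint⇔ S u) (from (∀∈⊎⇔∀∉→ S) restrained u)))

  feasible-resp : ∀ {x y} → x ≗ y → Feasible G x → Feasible G y
  feasible-resp x≗y (binary , hop , restraint) =
    (λ i → subst (λ z → z ≡ + 0 ⊎ z ≡ + 1) (x≗y i) (binary i)) ,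
    (λ u → subst (+ 1 ≤_) (sumℤ-cong (cong (a G u _ *_) ∘ x≗y)) (hop u)) ,
    (λ u → subst (_< + deg G u) (sumℤ-cong (cong (b G u _ *_) ∘ x≗y)) (restraint u))

  feasible⇒support : ∀ x → Feasible G x →
                     RestrainedHopDominating G (support x) × objective G x ≡ + ∣ support x ∣
  feasible⇒support x feasible =
    to (feasible-χ⇔restrainedHopDominating (support x)) (feasible-resp x≗χ feasible) ,
    trans (sumℤ-cong x≗χ) (sumℤ-χ (support x))
    where
    x≗χ : x ≗ χ (support x)
    x≗χ = χ-support x (proj₁ feasible)

  restrainedHopDominating? : Decidable (RestrainedHopDominating G)
  restrainedHopDominating? S =
    all? (λ u → ¬? (u ∈? S) →-dec any? (λ v → v ∈? S ×-dec Dist2? G u v)) ×-dec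
    all? (λ u → ¬? (u ∈? S) →-dec any? (λ v → ¬? (v ∈? S) ×-dec Adj? G u v))

  ⊤-restrainedHopDominating : RestrainedHopDominating G ⊤
  ⊤-restrainedHopDominating = (λ _ ∉⊤ → contradiction ∈⊤ ∉⊤) , (λ _ ∉⊤ → contradiction ∈⊤ ∉⊤)

mainTheorem3 : ∀ {n : ℕ} (G : Graph n) →
    Σ ℕ (λ k → IsRestrainedHopDominationNumber G k × IsOptimalValue G (+ k))
mainTheorem3 G with ∃-minimum-cardinality (restrainedHopDominating? G) (⊤ , ⊤-restrainedHopDominating G)
... | S , rhd , minimal =
  ∣ S ∣ , ((S , rhd , refl) , minimal) , (χ S , optimal , sumℤ-χ S) , lowerBound
  where
  optimal : Feasible G (χ S)
  optimal = from (feasible-χ⇔restrainedHopDominating G S) rhd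
  lowerBound : ∀ x → Feasible G x → + ∣ S ∣ ≤ objective G x
  lowerBound x feasible =
    let rhdSupport , objective≡ = feasible⇒support G x feasible
    in subst (+ ∣ S ∣ ≤_) (sym objective≡) (+≤+ (minimal (support x) rhdSupport))
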